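{- Let $\mathbf{X}=(X_1,\dots,X_T)$ be a sequence of random variables, each taking values in a finite set, and let $\alpha>0$. Suppose that for every $\mathbf{x}=(x_1,\dots,x_T)$ in the support of $\mathbf{X}$, $$\frac1T\sum_{i=1}^T\mathrm{cp}\big(X_i\mid X_{<i}=x_{<i}\big)\le\alpha,$$ where $X_{<i}=(X_1,\dots,X_{i-1})$, $x_{<i}=(x_1,\dots,x_{i-1})$, and $\mathrm{cp}(X_i\mid X_{<i}=x_{<i})$ is the collision probability of the conditional distribution of $X_i$ given $X_{<i}=x_{<i}$. Then $\mathrm{cp}(\mathbf{X})\le\alpha^T$.
   Context: The collision probability of a random variable $X$ is $\mathrm{cp}(X)=\sum_x\Pr[X=x]^2$.
   Formalization: The probabilities of the joint distribution of $\mathbf{X}$ and the bound α take rational values. -}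

module Defs where

open import Data.Nat as ℕ using (ℕ; zero; suc)
open import Data.Fin as Fin using (Fin; zero; suc)
open import Data.Fin.Properties using (all?; _<?_)
open import Data.List using (List; []; _∷_; map; concatMap; foldr; allFin)
open import Data.Bool using (Bool; if_then_else_; _∧_)
open import Data.Rational using (ℚ; 0ℚ; 1ℚ; _+_; _*_; _÷_; _≟_; ≢-nonZero)
open import Relation.Nullary using (yes; no; ¬_)
open import Relation.Nullary.Decidable using (⌊_⌋; _→-dec_)
open import Relation.Binary.PropositionalEquality using (_≡_)

-- An outcome of X = (X_1,…,X_T): X_i takes values in the finite set Fin (n i).
Seq : (T : ℕ) → (Fin T → ℕ) → Set
Seq T n = (i : Fin T) → Fin (n i)

consSeq : ∀ {T} {n : Fin (suc T) → ℕ} → Fin (n zero) → Seq T (λ i → n (suc i)) → Seq (suc T) n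
consSeq a f zero = a
consSeq a f (suc i) = f i

allSeq : (T : ℕ) (n : Fin T → ℕ) → List (Seq T n)
allSeq zero n = (λ ()) ∷ []
allSeq (suc T) n =
  concatMap (λ a → map (consSeq a) (allSeq T (λ i → n (suc i)))) (allFin (n zero))

sumℚ : List ℚ → ℚ
sumℚ = foldr _+_ 0ℚ

ΣSeq : ∀ {T} {n : Fin T → ℕ} → (Seq T n → ℚ) → ℚ
ΣSeq {T} {n} f = sumℚ (map f (allSeq T n))

powℚ : ℚ → ℕ → ℚ
powℚ q zero = 1ℚ
powℚ q (suc k) = q * powℚ q k

agreeBefore : ∀ {T} {n : Fin T → ℕ} → Fin T → Seq T n → Seq T n → Bool
agreeBefore i x y = ⌊ all? (λ j → (j <? i) →-dec (x j Fin.≟ y j)) ⌋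

prefixProb : ∀ {T} {n : Fin T → ℕ} → (Seq T n → ℚ) → Fin T → Seq T n → ℚ
prefixProb p i x = ΣSeq (λ y → if agreeBefore i x y then p y else 0ℚ)

prefixProbAt : ∀ {T} {n : Fin T → ℕ} → (Seq T n → ℚ) → (i : Fin T) → Seq T n → Fin (n i) → ℚ
prefixProbAt p i x a =
  ΣSeq (λ y → if agreeBefore i x y ∧ ⌊ y i Fin.≟ a ⌋ then p y else 0ℚ)

-- division, only used with a nonzero denominator (set to 0 otherwise)
divℚ : ℚ → ℚ → ℚ
divℚ q r with r ≟ 0ℚ
... | yes _ = 0ℚ
... | no r≢0 = _÷_ q r {{≢-nonZero r≢0}}

condCp : ∀ {T} {n : Fin T → ℕ} → (Seq T n → ℚ) → Fin T → Seq T n → ℚ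
condCp {n = n} p i x =
  sumℚ (map (λ a → let c = divℚ (prefixProbAt p i x a) (prefixProb p i x) in c * c)
            (allFin (n i)))

cp : ∀ {T} {n : Fin T → ℕ} → (Seq T n → ℚ) → ℚ
cp p = ΣSeq (λ x → p x * p x)

{-# OPTIONS --safe #-}
module Submission where

-- We prove, by induction on T, that arbitrary nonnegative weights w of total
-- mass S with Σᵢ cp(Xᵢ | x<ᵢ) ≤ B on the support satisfy cp(w) ≤ S² (B/T)^T;
-- the theorem is the case S = 1, B = Tα. Split off the first coordinate: with
-- S_a the mass of the fibre {X₁ = a} and C the collision probability of X₁,
-- cp(w) = Σ_a cp(fibre a) and Σ_a S_a² = C S². The conditional collision
-- probabilities of a fibre are those of w at the later indices, so every fibre
-- meets the hypothesis with budget B − C, and induction gives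
-- cp(w) ≤ S² C ((B − C)/(T − 1))^(T−1). Weighted AM-GM bounds
-- C ((B − C)/(T − 1))^(T−1) by (B/T)^T.

open import Data.Nat as ℕ using (ℕ; zero; suc; s≤s; z≤n; NonZero)
open import Data.Fin as Fin using (Fin; zero; suc)
open import Data.Fin.Properties using (all?; suc-injective)
import Data.Fin.Properties as Finₚ
open import Data.List using (List; []; _∷_; _++_; map; concatMap; allFin)
open import Data.List.Properties using (map-++; map-cong; map-∘; map-tabulate)
open import Data.List.Relation.Unary.All as All using (All; []; _∷_; universal)
open import Data.List.Relation.Unary.All.Properties using (¬Any⇒All¬)
open import Data.List.Relation.Unary.Any using (Any; here; there; any?; satisfied)
open import Data.Bool using (true; false; if_then_else_; _∧_)
open import Data.Product using (_×_; _,_)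
open import Data.Sum using (inj₁; inj₂)
open import Data.Empty using (⊥-elim)
open import Data.Integer as ℤ using (+_)
open import Data.Rational
  using (ℚ; 0ℚ; 1ℚ; _+_; _*_; _-_; -_; _/_; 1/_; _≤_; _<_; toℚᵘ; ≢-nonZero; nonNegative; nonPositive)
open import Data.Rational.Properties
import Data.Rational.Unnormalised as ℚᵘ
import Data.Rational.Unnormalised.Properties as ℚᵘ
open import Data.Rational.Solver using (module +-*-Solver)
open import Data.Integer.Tactic.RingSolver using (solve-∀)
open import Function using (_∘_; id; _⇔_; mk⇔)
open import Relation.Nullary using (¬_; yes; no)
open import Relation.Nullary.Decidable
  using (Dec; does; ⌊_⌋; ⌊⌋-map′; isYes≗does; dec-true; does-⇔; _×-dec_; _→-dec_)
open import Relation.Binary.PropositionalEquality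
open import Defs

open +-*-Solver

*-nonNeg : ∀ {p q} → 0ℚ ≤ p → 0ℚ ≤ q → 0ℚ ≤ p * q
*-nonNeg {p} {q} 0≤p 0≤q =
  nonNegative⁻¹ _ {{nonNeg*nonNeg⇒nonNeg p {{nonNegative 0≤p}} q {{nonNegative 0≤q}}}}

p*p-nonNeg : ∀ p → 0ℚ ≤ p * p
p*p-nonNeg p with ≤-total 0ℚ p
... | inj₁ 0≤p = *-nonNeg 0≤p 0≤p
... | inj₂ p≤0 = nonNegative⁻¹ _ {{nonPos*nonPos⇒nonPos p {{nonPositive p≤0}} p {{nonPositive p≤0}}}}

p≤p+q : ∀ {p q} → 0ℚ ≤ q → p ≤ p + q
p≤p+q {p} 0≤q = subst (_≤ p + _) (+-identityʳ p) (+-monoʳ-≤ p 0≤q)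

p≤q⇒0≤q-p : ∀ {p q} → p ≤ q → 0ℚ ≤ q - p
p≤q⇒0≤q-p {p} {q} p≤q = subst (_≤ q - p) (+-inverseʳ p) (+-monoˡ-≤ (- p) p≤q)

0≤q-p⇒p≤q : ∀ {p q} → 0ℚ ≤ q - p → p ≤ q
0≤q-p⇒p≤q {p} {q} 0≤q-p =
  subst₂ _≤_ (+-identityˡ p) (solve 2 (λ p q → (q :- p) :+ p := q) refl p q) (+-monoˡ-≤ p 0≤q-p)

p+q≤r⇒q≤r-p : ∀ {p q r} → p + q ≤ r → q ≤ r - p
p+q≤r⇒q≤r-p {p} {q} {r} p+q≤r = 0≤q-p⇒p≤q (subst (0ℚ ≤_)
  (solve 3 (λ p q r → r :- (p :+ q) := (r :- p) :- q) refl p q r) (p≤q⇒0≤q-p p+q≤r))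

divℚ-*-cancel : ∀ p {q} → q ≢ 0ℚ → divℚ p q * q ≡ p
divℚ-*-cancel p {q} q≢0 with q ≟ 0ℚ
... | yes q≡0 = ⊥-elim (q≢0 q≡0)
... | no q≢0′ = begin
  p * (1/ q) {{≢-nonZero q≢0′}} * q     ≡⟨ *-assoc p _ q ⟩
  p * ((1/ q) {{≢-nonZero q≢0′}} * q)   ≡⟨ cong (p *_) (*-inverseˡ q {{≢-nonZero q≢0′}}) ⟩
  p * 1ℚ                                ≡⟨ *-identityʳ p ⟩
  p ∎
  where open ≡-Reasoning

powℚ-nonNeg : ∀ {p} k → 0ℚ ≤ p → 0ℚ ≤ powℚ p k
powℚ-nonNeg zero 0≤p = nonNegative⁻¹ 1ℚ
powℚ-nonNeg (suc k) 0≤p = *-nonNeg 0≤p (powℚ-nonNeg k 0≤p)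

powℚ-mono-≤ : ∀ {p q} k → 0ℚ ≤ p → p ≤ q → powℚ p k ≤ powℚ q k
powℚ-mono-≤ zero 0≤p p≤q = ≤-refl
powℚ-mono-≤ {p} {q} (suc k) 0≤p p≤q = ≤-trans
  (*-monoʳ-≤-nonNeg (powℚ p k) {{nonNegative (powℚ-nonNeg k 0≤p)}} p≤q)
  (*-monoˡ-≤-nonNeg q {{nonNegative (≤-trans 0≤p p≤q)}} (powℚ-mono-≤ k 0≤p p≤q))

0≤[p-q]*[pᵏ-qᵏ] : ∀ {p q} k → 0ℚ ≤ p → 0ℚ ≤ q → 0ℚ ≤ (p - q) * (powℚ p k - powℚ q k)
0≤[p-q]*[pᵏ-qᵏ] {p} {q} k 0≤p 0≤q with ≤-total p q
... | inj₁ p≤q = subst (0ℚ ≤_)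
  (solve 4 (λ p q x y → (q :- p) :* (y :- x) := (p :- q) :* (x :- y)) refl p q (powℚ p k) (powℚ q k))
  (*-nonNeg (p≤q⇒0≤q-p p≤q) (p≤q⇒0≤q-p (powℚ-mono-≤ k 0≤p p≤q)))
... | inj₂ q≤p = *-nonNeg (p≤q⇒0≤q-p q≤p) (p≤q⇒0≤q-p (powℚ-mono-≤ k 0≤q q≤p))

fromℕ : ℕ → ℚ
fromℕ zero = 0ℚ
fromℕ (suc k) = 1ℚ + fromℕ k

fromℕ-nonNeg : ∀ k → 0ℚ ≤ fromℕ k
fromℕ-nonNeg zero = ≤-refl
fromℕ-nonNeg (suc k) =
  nonNegative⁻¹ _ {{nonNeg+nonNeg⇒nonNeg 1ℚ (fromℕ k) {{nonNegative (fromℕ-nonNeg k)}}}}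

toℚᵘ-fromℕ : ∀ k → toℚᵘ (fromℕ k) ℚᵘ.≃ ℚᵘ.mkℚᵘ (+ k) 0
toℚᵘ-fromℕ zero = ℚᵘ.≃-refl
toℚᵘ-fromℕ (suc k) = begin
  toℚᵘ (1ℚ + fromℕ k)              ≈⟨ toℚᵘ-homo-+ 1ℚ (fromℕ k) ⟩
  toℚᵘ 1ℚ ℚᵘ.+ toℚᵘ (fromℕ k)      ≈⟨ ℚᵘ.+-congʳ (toℚᵘ 1ℚ) (toℚᵘ-fromℕ k) ⟩
  toℚᵘ 1ℚ ℚᵘ.+ ℚᵘ.mkℚᵘ (+ k) 0     ≈⟨ ℚᵘ.*≡* (cross-multiplied (+ k)) ⟩
  ℚᵘ.mkℚᵘ (+ suc k) 0 ∎
  where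
  open ℚᵘ.≃-Reasoning
  cross-multiplied : ∀ x → (+ 1 ℤ.* + 1 ℤ.+ x ℤ.* + 1) ℤ.* + 1 ≡ (+ 1 ℤ.+ x) ℤ.* (+ 1 ℤ.* + 1)
  cross-multiplied = solve-∀

1/[1+k]*[1+k]≡1 : ∀ k → (+ 1 / suc k) * fromℕ (suc k) ≡ 1ℚ
1/[1+k]*[1+k]≡1 k = toℚᵘ-injective (begin
  toℚᵘ ((+ 1 / suc k) * fromℕ (suc k))
    ≈⟨ toℚᵘ-homo-* (+ 1 / suc k) (fromℕ (suc k)) ⟩
  toℚᵘ (+ 1 / suc k) ℚᵘ.* toℚᵘ (fromℕ (suc k))
    ≈⟨ ℚᵘ.*-cong (toℚᵘ-fromℚᵘ (ℚᵘ.mkℚᵘ (+ 1) k)) (toℚᵘ-fromℕ (suc k)) ⟩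
  ℚᵘ.mkℚᵘ (+ 1) k ℚᵘ.* ℚᵘ.mkℚᵘ (+ suc k) 0
    ≈⟨ ℚᵘ.*≡* (cross-multiplied (+ suc k)) ⟩
  toℚᵘ 1ℚ ∎)
  where
  open ℚᵘ.≃-Reasoning
  cross-multiplied : ∀ x → (+ 1 ℤ.* x) ℤ.* + 1 ≡ + 1 ℤ.* (x ℤ.* + 1)
  cross-multiplied = solve-∀

-- The junk value of p ÷ℕ 0 is harmless: it only ever occurs raised to the power 0.
_÷ℕ_ : ℚ → ℕ → ℚ
p ÷ℕ zero = 0ℚ
p ÷ℕ suc m = (+ 1 / suc m) * p

÷ℕ-nonNeg : ∀ {p} k → 0ℚ ≤ p → 0ℚ ≤ p ÷ℕ k
÷ℕ-nonNeg zero 0≤p = ≤-refl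
÷ℕ-nonNeg (suc m) 0≤p = *-nonNeg (nonNegative⁻¹ (+ 1 / suc m) {{normalize-nonNeg 1 (suc m)}}) 0≤p

÷ℕ-*-cancel : ∀ m p → (fromℕ (suc m) * p) ÷ℕ suc m ≡ p
÷ℕ-*-cancel m p = begin
  (+ 1 / suc m) * (fromℕ (suc m) * p)   ≡⟨ *-assoc (+ 1 / suc m) (fromℕ (suc m)) p ⟨
  ((+ 1 / suc m) * fromℕ (suc m)) * p   ≡⟨ cong (_* p) (1/[1+k]*[1+k]≡1 m) ⟩
  1ℚ * p                                ≡⟨ *-identityˡ p ⟩
  p ∎
  where open ≡-Reasoning

*-÷ℕ-cancel : ∀ m p → fromℕ (suc m) * (p ÷ℕ suc m) ≡ p
*-÷ℕ-cancel m p = trans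
  (solve 3 (λ n u p → n :* (u :* p) := u :* (n :* p)) refl (fromℕ (suc m)) (+ 1 / suc m) p)
  (÷ℕ-*-cancel m p)

*-÷ℕ-≤ : ∀ k {p} → 0ℚ ≤ p → fromℕ k * (p ÷ℕ k) ≤ p
*-÷ℕ-≤ zero 0≤p = ≤-trans (≤-reflexive (*-zeroˡ 0ℚ)) 0≤p
*-÷ℕ-≤ (suc m) {p} _ = ≤-reflexive (*-÷ℕ-cancel m p)

-- The step adds β times the induction hypothesis to 0 ≤ (α − β)(α^(k+1) − β^(k+1)).
AM-GM : ∀ k {α β} → 0ℚ ≤ α → 0ℚ ≤ β →
  ((1ℚ + fromℕ k) * α - fromℕ k * β) * powℚ β k ≤ powℚ α (suc k)
AM-GM zero {α} {β} _ _ =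
  ≤-reflexive (solve 2 (λ α β → ((con 1ℚ :+ con 0ℚ) :* α :- con 0ℚ :* β) :* con 1ℚ := α :* con 1ℚ) refl α β)
AM-GM (suc k) {α} {β} 0≤α 0≤β = 0≤q-p⇒p≤q (subst (0ℚ ≤_) identity
  (+-mono-≤ (*-nonNeg 0≤β (p≤q⇒0≤q-p (AM-GM k 0≤α 0≤β))) (0≤[p-q]*[pᵏ-qᵏ] (suc k) 0≤α 0≤β)))
  where
  identity : β * (α * powℚ α k - ((1ℚ + fromℕ k) * α - fromℕ k * β) * powℚ β k)
               + (α - β) * (α * powℚ α k - β * powℚ β k)
           ≡ α * (α * powℚ α k) - ((1ℚ + (1ℚ + fromℕ k)) * α - (1ℚ + fromℕ k) * β) * (β * powℚ β k)
  identity = solve 5 (λ a b K X Y →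
      b :* (a :* X :- ((con 1ℚ :+ K) :* a :- K :* b) :* Y) :+ (a :- b) :* (a :* X :- b :* Y)
    := a :* (a :* X) :- ((con 1ℚ :+ (con 1ℚ :+ K)) :* a :- (con 1ℚ :+ K) :* b) :* (b :* Y))
    refl α β (fromℕ k) (powℚ α k) (powℚ β k)

sum-++ : ∀ xs ys → sumℚ (xs ++ ys) ≡ sumℚ xs + sumℚ ys
sum-++ [] ys = sym (+-identityˡ (sumℚ ys))
sum-++ (x ∷ xs) ys = trans (cong (_+_ x) (sum-++ xs ys)) (sym (+-assoc x (sumℚ xs) (sumℚ ys)))

sum-concatMap : ∀ {A B : Set} (f : B → ℚ) (g : A → List B) xs →
  sumℚ (map f (concatMap g xs)) ≡ sumℚ (map (λ a → sumℚ (map f (g a))) xs)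
sum-concatMap f g [] = refl
sum-concatMap f g (x ∷ xs) = begin
  sumℚ (map f (g x ++ concatMap g xs))                   ≡⟨ cong sumℚ (map-++ f (g x) (concatMap g xs)) ⟩
  sumℚ (map f (g x) ++ map f (concatMap g xs))           ≡⟨ sum-++ (map f (g x)) _ ⟩
  sumℚ (map f (g x)) + sumℚ (map f (concatMap g xs))     ≡⟨ cong (_+_ (sumℚ (map f (g x)))) (sum-concatMap f g xs) ⟩
  sumℚ (map f (g x)) + sumℚ (map (λ a → sumℚ (map f (g a))) xs) ∎
  where open ≡-Reasoning

sum-cong : ∀ {A : Set} {f g : A → ℚ} → (∀ x → f x ≡ g x) → ∀ xs → sumℚ (map f xs) ≡ sumℚ (map g xs)
sum-cong f≗g xs = cong sumℚ (map-cong f≗g xs)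

sum-mono-≤ : ∀ {A : Set} {f g : A → ℚ} → (∀ x → f x ≤ g x) → ∀ xs → sumℚ (map f xs) ≤ sumℚ (map g xs)
sum-mono-≤ f≤g [] = ≤-refl
sum-mono-≤ f≤g (x ∷ xs) = +-mono-≤ (f≤g x) (sum-mono-≤ f≤g xs)

sum-nonNeg : ∀ {A : Set} {f : A → ℚ} → (∀ x → 0ℚ ≤ f x) → ∀ xs → 0ℚ ≤ sumℚ (map f xs)
sum-nonNeg 0≤f [] = ≤-refl
sum-nonNeg {f = f} 0≤f (x ∷ xs) =
  subst (_≤ f x + sumℚ (map f xs)) (+-identityˡ 0ℚ) (+-mono-≤ (0≤f x) (sum-nonNeg 0≤f xs))

sum-pos : ∀ {A : Set} {f : A → ℚ} → (∀ x → 0ℚ ≤ f x) →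
  ∀ {xs} → Any (λ x → 0ℚ < f x) xs → 0ℚ < sumℚ (map f xs)
sum-pos {f = f} 0≤f {x ∷ xs} (here 0<fx) =
  subst (_< f x + sumℚ (map f xs)) (+-identityʳ 0ℚ) (+-mono-<-≤ 0<fx (sum-nonNeg 0≤f xs))
sum-pos {f = f} 0≤f {x ∷ xs} (there any) =
  subst (_< f x + sumℚ (map f xs)) (+-identityˡ 0ℚ) (+-mono-≤-< (0≤f x) (sum-pos 0≤f any))

sum-zero : ∀ {A : Set} {f : A → ℚ} {xs} → All (λ x → f x ≡ 0ℚ) xs → sumℚ (map f xs) ≡ 0ℚ
sum-zero [] = refl
sum-zero (fx≡0 ∷ fxs≡0) = trans (cong₂ _+_ fx≡0 (sum-zero fxs≡0)) (+-identityˡ 0ℚ)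

sum-*ʳ : ∀ {A : Set} (f : A → ℚ) c xs → sumℚ (map f xs) * c ≡ sumℚ (map (λ x → f x * c) xs)
sum-*ʳ f c [] = *-zeroˡ c
sum-*ʳ f c (x ∷ xs) = trans (*-distribʳ-+ c (f x) _) (cong (_+_ (f x * c)) (sum-*ʳ f c xs))

sum-allFin-suc : ∀ m (g : Fin (suc m) → ℚ) →
  sumℚ (map g (allFin (suc m))) ≡ g zero + sumℚ (map (g ∘ suc) (allFin m))
sum-allFin-suc m g =
  cong (λ l → g zero + sumℚ l) (trans (map-tabulate suc g) (sym (map-tabulate id (g ∘ suc))))

sum-if-≟ : ∀ m (f : Fin m → ℚ) a →
  sumℚ (map (λ b → if ⌊ b Fin.≟ a ⌋ then f b else 0ℚ) (allFin m)) ≡ f a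
sum-if-≟ (suc m) f zero = begin
  sumℚ (map (λ b → if ⌊ b Fin.≟ zero ⌋ then f b else 0ℚ) (allFin (suc m)))
    ≡⟨ sum-allFin-suc m (λ b → if ⌊ b Fin.≟ zero ⌋ then f b else 0ℚ) ⟩
  f zero + sumℚ (map (λ _ → 0ℚ) (allFin m))
    ≡⟨ cong (_+_ (f zero)) (sum-zero (universal (λ _ → refl) (allFin m))) ⟩
  f zero + 0ℚ
    ≡⟨ +-identityʳ (f zero) ⟩
  f zero ∎
  where open ≡-Reasoning
sum-if-≟ (suc m) f (suc a) = begin
  sumℚ (map (λ b → if ⌊ b Fin.≟ suc a ⌋ then f b else 0ℚ) (allFin (suc m)))
    ≡⟨ sum-allFin-suc m (λ b → if ⌊ b Fin.≟ suc a ⌋ then f b else 0ℚ) ⟩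
  0ℚ + sumℚ (map (λ b → if ⌊ suc b Fin.≟ suc a ⌋ then f (suc b) else 0ℚ) (allFin m))
    ≡⟨ +-identityˡ _ ⟩
  sumℚ (map (λ b → if ⌊ suc b Fin.≟ suc a ⌋ then f (suc b) else 0ℚ) (allFin m))
    ≡⟨ sum-cong (λ b → cong (if_then f (suc b) else 0ℚ) (⌊⌋-map′ (cong suc) suc-injective (b Fin.≟ a)))
                (allFin m) ⟩
  sumℚ (map (λ b → if ⌊ b Fin.≟ a ⌋ then f (suc b) else 0ℚ) (allFin m))
    ≡⟨ sum-if-≟ m (f ∘ suc) a ⟩
  f (suc a) ∎
  where open ≡-Reasoning

-- Splitting off the first coordinate

fiber : ∀ {T} {n : Fin (suc T) → ℕ} {A : Set} →
  (Seq (suc T) n → A) → Fin (n zero) → Seq T (λ i → n (suc i)) → A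
fiber f a = f ∘ consSeq a

ΣSeq-cons : ∀ {T} {n : Fin (suc T) → ℕ} (f : Seq (suc T) n → ℚ) →
  ΣSeq f ≡ sumℚ (map (λ a → ΣSeq (fiber f a)) (allFin (n zero)))
ΣSeq-cons {T} {n} f = trans (sum-concatMap f _ (allFin (n zero)))
  (sum-cong (λ a → cong sumℚ (sym (map-∘ (allSeq T (λ i → n (suc i)))))) (allFin (n zero)))

ΣSeq-if : ∀ {T} {n : Fin T → ℕ} b (f : Seq T n → ℚ) →
  ΣSeq (λ y → if b then f y else 0ℚ) ≡ (if b then ΣSeq f else 0ℚ)
ΣSeq-if true f = refl
ΣSeq-if {T} {n} false f = sum-zero (universal (λ _ → refl) (allSeq T n))

if-∧ : ∀ b c (q : ℚ) → (if b ∧ c then q else 0ℚ) ≡ (if b then (if c then q else 0ℚ) else 0ℚ)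
if-∧ true c q = refl
if-∧ false c q = refl

module _ {T : ℕ} {n : Fin T → ℕ} where

  AgreeBefore : Fin T → Seq T n → Seq T n → Set
  AgreeBefore i x y = ∀ j → (j Fin.< i → x j ≡ y j)

  -- agreeBefore i x y is ⌊ agreeBefore? i x y ⌋ by definition.
  agreeBefore? : ∀ i x y → Dec (AgreeBefore i x y)
  agreeBefore? i x y = all? (λ j → (j Finₚ.<? i) →-dec (x j Fin.≟ y j))

agreeBefore-zero : ∀ {T} {n : Fin (suc T) → ℕ} (x y : Seq (suc T) n) → agreeBefore zero x y ≡ true
agreeBefore-zero {n = n} x y =
  trans (isYes≗does (agreeBefore? {n = n} zero x y)) (dec-true (agreeBefore? {n = n} zero x y) (λ _ ()))

agreeBefore-cons : ∀ {T} {n : Fin (suc T) → ℕ} i a b (y z : Seq T (λ j → n (suc j))) →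
  agreeBefore {n = n} (suc i) (consSeq a y) (consSeq b z) ≡ ⌊ b Fin.≟ a ⌋ ∧ agreeBefore i y z
agreeBefore-cons {n = n} i a b y z = begin
  ⌊ agreeBefore? {n = n} (suc i) (consSeq a y) (consSeq b z) ⌋
    ≡⟨ isYes≗does _ ⟩
  does (agreeBefore? {n = n} (suc i) (consSeq a y) (consSeq b z))
    ≡⟨ does-⇔ cons⇔ (agreeBefore? (suc i) (consSeq a y) (consSeq b z)) ((b Fin.≟ a) ×-dec agreeBefore? i y z) ⟩
  does (b Fin.≟ a) ∧ does (agreeBefore? i y z)
    ≡⟨ sym (cong₂ _∧_ (isYes≗does (b Fin.≟ a)) (isYes≗does (agreeBefore? i y z))) ⟩
  ⌊ b Fin.≟ a ⌋ ∧ agreeBefore i y z ∎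
  where
  open ≡-Reasoning
  cons⇔ : AgreeBefore {n = n} (suc i) (consSeq a y) (consSeq b z) ⇔ (b ≡ a × AgreeBefore i y z)
  cons⇔ = mk⇔ (λ agree → sym (agree zero (s≤s z≤n)) , λ j j<i → agree (suc j) (s≤s j<i))
               λ { (b≡a , agree) zero _ → sym b≡a ; (b≡a , agree) (suc j) (s≤s j<i) → agree j j<i }

prefixProbAt≡prefixProb : ∀ {T} {n : Fin T → ℕ} (p : Seq T n → ℚ) i x a →
  prefixProbAt p i x a ≡ prefixProb (λ y → if ⌊ y i Fin.≟ a ⌋ then p y else 0ℚ) i x
prefixProbAt≡prefixProb {T} {n} p i x a =
  sum-cong (λ y → if-∧ (agreeBefore i x y) ⌊ y i Fin.≟ a ⌋ (p y)) (allSeq T n)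

module _ {T : ℕ} {n : Fin (suc T) → ℕ} where

  prefixProb-zero : ∀ (w : Seq (suc T) n → ℚ) x → prefixProb w zero x ≡ ΣSeq w
  prefixProb-zero w x = sum-cong (λ y → cong (if_then w y else 0ℚ) (agreeBefore-zero x y)) (allSeq (suc T) n)

  prefixProbAt-zero : ∀ (w : Seq (suc T) n → ℚ) x c → prefixProbAt w zero x c ≡ ΣSeq (fiber w c)
  prefixProbAt-zero w x c = begin
    prefixProbAt w zero x c
      ≡⟨ prefixProbAt≡prefixProb w zero x c ⟩
    prefixProb (λ y → if ⌊ y zero Fin.≟ c ⌋ then w y else 0ℚ) zero x
      ≡⟨ prefixProb-zero _ x ⟩
    ΣSeq (λ y → if ⌊ y zero Fin.≟ c ⌋ then w y else 0ℚ)
      ≡⟨ ΣSeq-cons {n = n} (λ x → if ⌊ x zero Fin.≟ c ⌋ then w x else 0ℚ) ⟩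
    sumℚ (map (λ b → ΣSeq (λ z → if ⌊ b Fin.≟ c ⌋ then fiber w b z else 0ℚ)) (allFin (n zero)))
      ≡⟨ sum-cong (λ b → ΣSeq-if ⌊ b Fin.≟ c ⌋ (fiber w b)) (allFin (n zero)) ⟩
    sumℚ (map (λ b → if ⌊ b Fin.≟ c ⌋ then ΣSeq (fiber w b) else 0ℚ) (allFin (n zero)))
      ≡⟨ sum-if-≟ (n zero) (λ b → ΣSeq (fiber w b)) c ⟩
    ΣSeq (fiber w c) ∎
    where open ≡-Reasoning

  prefixProb-cons : ∀ (w : Seq (suc T) n → ℚ) i a y →
    prefixProb w (suc i) (consSeq a y) ≡ prefixProb (fiber w a) i y
  prefixProb-cons w i a y = begin
    prefixProb w (suc i) (consSeq a y)
      ≡⟨ ΣSeq-cons {n = n} (λ x → if agreeBefore (suc i) (consSeq a y) x then w x else 0ℚ) ⟩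
    sumℚ (map (λ b → ΣSeq (λ z → if agreeBefore (suc i) (consSeq a y) (consSeq b z) then fiber w b z else 0ℚ))
              (allFin (n zero)))
      ≡⟨ sum-cong (λ b → sum-cong (λ z → restrict b z) (allSeq T _)) (allFin (n zero)) ⟩
    sumℚ (map (λ b → ΣSeq (λ z → if ⌊ b Fin.≟ a ⌋ then below b z else 0ℚ)) (allFin (n zero)))
      ≡⟨ sum-cong (λ b → ΣSeq-if ⌊ b Fin.≟ a ⌋ (below b)) (allFin (n zero)) ⟩
    sumℚ (map (λ b → if ⌊ b Fin.≟ a ⌋ then prefixProb (fiber w b) i y else 0ℚ) (allFin (n zero)))
      ≡⟨ sum-if-≟ (n zero) (λ b → prefixProb (fiber w b) i y) a ⟩
    prefixProb (fiber w a) i y ∎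
    where
    open ≡-Reasoning
    below : Fin (n zero) → Seq T (λ j → n (suc j)) → ℚ
    below b z = if agreeBefore i y z then fiber w b z else 0ℚ
    restrict : ∀ b z → (if agreeBefore (suc i) (consSeq a y) (consSeq b z) then fiber w b z else 0ℚ)
                     ≡ (if ⌊ b Fin.≟ a ⌋ then below b z else 0ℚ)
    restrict b z = trans (cong (if_then fiber w b z else 0ℚ) (agreeBefore-cons i a b y z))
                         (if-∧ ⌊ b Fin.≟ a ⌋ (agreeBefore i y z) (fiber w b z))

  prefixProbAt-cons : ∀ (w : Seq (suc T) n → ℚ) i a y c →
    prefixProbAt w (suc i) (consSeq a y) c ≡ prefixProbAt (fiber w a) i y c
  prefixProbAt-cons w i a y c = begin
    prefixProbAt w (suc i) (consSeq a y) c
      ≡⟨ prefixProbAt≡prefixProb w (suc i) (consSeq a y) c ⟩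
    prefixProb (λ x → if ⌊ x (suc i) Fin.≟ c ⌋ then w x else 0ℚ) (suc i) (consSeq a y)
      ≡⟨ prefixProb-cons _ i a y ⟩
    prefixProb (λ z → if ⌊ z i Fin.≟ c ⌋ then fiber w a z else 0ℚ) i y
      ≡⟨ sym (prefixProbAt≡prefixProb (fiber w a) i y c) ⟩
    prefixProbAt (fiber w a) i y c ∎
    where open ≡-Reasoning

condCpSum : ∀ {T} {n : Fin T → ℕ} → (Seq T n → ℚ) → Seq T n → ℚ
condCpSum {T} p x = sumℚ (map (λ i → condCp p i x) (allFin T))

condCp-nonNeg : ∀ {T} {n : Fin T → ℕ} (p : Seq T n → ℚ) i x → 0ℚ ≤ condCp p i x
condCp-nonNeg {n = n} p i x =
  sum-nonNeg (λ a → p*p-nonNeg (divℚ (prefixProbAt p i x a) (prefixProb p i x))) (allFin (n i))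

cp-zero : ∀ {n : Fin zero → ℕ} (p : Seq zero n → ℚ) → cp p ≡ (ΣSeq p * ΣSeq p) * 1ℚ
cp-zero p = solve 1 (λ q → q :* q :+ con 0ℚ := ((q :+ con 0ℚ) :* (q :+ con 0ℚ)) :* con 1ℚ) refl (p (λ ()))

cp-no-support : ∀ {T} {n : Fin T → ℕ} (p : Seq T n → ℚ) → (∀ x → 0ℚ ≤ p x) →
  ¬ Any (λ x → 0ℚ < p x) (allSeq T n) → cp p ≡ 0ℚ
cp-no-support {T} {n} p 0≤p ¬supp = sum-zero (All.map p≯0⇒p²≡0 (¬Any⇒All¬ (allSeq T n) ¬supp))
  where
  p≯0⇒p²≡0 : ∀ {x} → ¬ 0ℚ < p x → p x * p x ≡ 0ℚ
  p≯0⇒p²≡0 {x} p≯0 = trans (cong (λ q → q * q) (≤-antisym (≮⇒≥ p≯0) (0≤p x))) (*-zeroˡ 0ℚ)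

module _ {T : ℕ} {n : Fin (suc T) → ℕ} (w : Seq (suc T) n → ℚ) where

  marginalCp : ℚ
  marginalCp = sumℚ (map (λ a → let c = divℚ (ΣSeq (fiber w a)) (ΣSeq w) in c * c) (allFin (n zero)))

  marginalCp-nonNeg : 0ℚ ≤ marginalCp
  marginalCp-nonNeg = sum-nonNeg (λ a → p*p-nonNeg (divℚ (ΣSeq (fiber w a)) (ΣSeq w))) (allFin (n zero))

  marginalCp-*-mass² : ΣSeq w ≢ 0ℚ →
    marginalCp * (ΣSeq w * ΣSeq w) ≡ sumℚ (map (λ a → ΣSeq (fiber w a) * ΣSeq (fiber w a)) (allFin (n zero)))
  marginalCp-*-mass² S≢0 = trans (sum-*ʳ _ (ΣSeq w * ΣSeq w) (allFin (n zero))) (sum-cong square (allFin (n zero)))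
    where
    square : ∀ a → let c = divℚ (ΣSeq (fiber w a)) (ΣSeq w) in
      (c * c) * (ΣSeq w * ΣSeq w) ≡ ΣSeq (fiber w a) * ΣSeq (fiber w a)
    square a = trans
      (solve 2 (λ c s → (c :* c) :* (s :* s) := (c :* s) :* (c :* s)) refl (divℚ (ΣSeq (fiber w a)) (ΣSeq w)) (ΣSeq w))
      (cong (λ q → q * q) (divℚ-*-cancel (ΣSeq (fiber w a)) S≢0))

  condCp-zero : ∀ x → condCp w zero x ≡ marginalCp
  condCp-zero x = sum-cong
    (λ a → cong₂ (λ u v → divℚ u v * divℚ u v) (prefixProbAt-zero w x a) (prefixProb-zero w x))
    (allFin (n zero))

  condCp-cons : ∀ i a y → condCp w (suc i) (consSeq a y) ≡ condCp (fiber w a) i y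
  condCp-cons i a y = sum-cong
    (λ c → cong₂ (λ u v → divℚ u v * divℚ u v) (prefixProbAt-cons w i a y c) (prefixProb-cons w i a y))
    (allFin (n (suc i)))

  condCpSum-suc : ∀ x → condCpSum w x ≡ marginalCp + sumℚ (map (λ i → condCp w (suc i) x) (allFin T))
  condCpSum-suc x = trans (sum-allFin-suc T (λ i → condCp w i x))
    (cong (_+ sumℚ (map (λ i → condCp w (suc i) x) (allFin T))) (condCp-zero x))

  condCpSum-cons : ∀ a y → condCpSum w (consSeq a y) ≡ marginalCp + condCpSum (fiber w a) y
  condCpSum-cons a y = trans (condCpSum-suc (consSeq a y))
    (cong (_+_ marginalCp) (sum-cong (λ i → condCp-cons i a y) (allFin T)))

  module _ {B : ℚ} (bound : ∀ x → 0ℚ < w x → condCpSum w x ≤ B) where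

    marginalCp-≤ : Any (λ x → 0ℚ < w x) (allSeq (suc T) n) → marginalCp ≤ B
    marginalCp-≤ supp with x , 0<wx ← satisfied supp = begin
      marginalCp
        ≤⟨ p≤p+q (sum-nonNeg (λ i → condCp-nonNeg w (suc i) x) (allFin T)) ⟩
      marginalCp + sumℚ (map (λ i → condCp w (suc i) x) (allFin T))
        ≡⟨ condCpSum-suc x ⟨
      condCpSum w x
        ≤⟨ bound x 0<wx ⟩
      B ∎
      where open ≤-Reasoning

    fiber-condCpSum-≤ : ∀ a y → 0ℚ < fiber w a y → condCpSum (fiber w a) y ≤ B - marginalCp
    fiber-condCpSum-≤ a y 0<wy = p+q≤r⇒q≤r-p (subst (_≤ B) (condCpSum-cons a y) (bound (consSeq a y) 0<wy))

  cp-bound-step : ∀ {B} → ΣSeq w ≢ 0ℚ → marginalCp ≤ B →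
    (∀ a → cp (fiber w a) ≤ (ΣSeq (fiber w a) * ΣSeq (fiber w a)) * powℚ ((B - marginalCp) ÷ℕ T) T) →
    cp w ≤ (ΣSeq w * ΣSeq w) * powℚ (B ÷ℕ suc T) (suc T)
  cp-bound-step {B} S≢0 C≤B fiber-bound = begin
    cp w
      ≡⟨ ΣSeq-cons (λ x → w x * w x) ⟩
    sumℚ (map (λ a → cp (fiber w a)) (allFin (n zero)))
      ≤⟨ sum-mono-≤ fiber-bound (allFin (n zero)) ⟩
    sumℚ (map (λ a → (ΣSeq (fiber w a) * ΣSeq (fiber w a)) * powℚ β′ T) (allFin (n zero)))
      ≡⟨ sum-*ʳ (λ a → ΣSeq (fiber w a) * ΣSeq (fiber w a)) (powℚ β′ T) (allFin (n zero)) ⟨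
    sumℚ (map (λ a → ΣSeq (fiber w a) * ΣSeq (fiber w a)) (allFin (n zero))) * powℚ β′ T
      ≡⟨ cong (_* powℚ β′ T) (marginalCp-*-mass² S≢0) ⟨
    (C * (S * S)) * powℚ β′ T
      ≡⟨ solve 3 (λ c s q → (c :* (s :* s)) :* q := (s :* s) :* (c :* q)) refl C S (powℚ β′ T) ⟩
    (S * S) * (C * powℚ β′ T)
      ≤⟨ *-monoˡ-≤-nonNeg (S * S) {{nonNegative (p*p-nonNeg S)}} C*β′ᵀ≤βᵀ⁺¹ ⟩
    (S * S) * powℚ β (suc T) ∎
    where
    open ≤-Reasoning
    S = ΣSeq w
    C = marginalCp
    β = B ÷ℕ suc T
    β′ = (B - C) ÷ℕ T
    0≤β′ : 0ℚ ≤ β′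
    0≤β′ = ÷ℕ-nonNeg T (p≤q⇒0≤q-p C≤B)
    C≤tangent : C ≤ (1ℚ + fromℕ T) * β - fromℕ T * β′
    C≤tangent = begin
      C                                  ≡⟨ solve 2 (λ b c → c := b :- (b :- c)) refl B C ⟩
      B - (B - C)                        ≤⟨ +-monoʳ-≤ B (neg-antimono-≤ (*-÷ℕ-≤ T (p≤q⇒0≤q-p C≤B))) ⟩
      B - fromℕ T * β′                   ≡⟨ cong (_- fromℕ T * β′) (*-÷ℕ-cancel T B) ⟨
      (1ℚ + fromℕ T) * β - fromℕ T * β′ ∎
    C*β′ᵀ≤βᵀ⁺¹ : C * powℚ β′ T ≤ powℚ β (suc T)
    C*β′ᵀ≤βᵀ⁺¹ = ≤-trans
      (*-monoʳ-≤-nonNeg (powℚ β′ T) {{nonNegative (powℚ-nonNeg T 0≤β′)}} C≤tangent)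
      (AM-GM T (÷ℕ-nonNeg (suc T) (≤-trans marginalCp-nonNeg C≤B)) 0≤β′)

cp-bound : ∀ T {n : Fin T → ℕ} (w : Seq T n → ℚ) → (∀ x → 0ℚ ≤ w x) → ∀ {B} → 0ℚ ≤ B →
  (∀ x → 0ℚ < w x → condCpSum w x ≤ B) → cp w ≤ (ΣSeq w * ΣSeq w) * powℚ (B ÷ℕ T) T
cp-bound zero w _ _ _ = ≤-reflexive (cp-zero w)
cp-bound (suc T) {n} w 0≤w {B} 0≤B bound with any? (λ x → 0ℚ <? w x) (allSeq (suc T) n)
... | no ¬supp = subst (_≤ (ΣSeq w * ΣSeq w) * powℚ (B ÷ℕ suc T) (suc T)) (sym (cp-no-support w 0≤w ¬supp))
  (*-nonNeg (p*p-nonNeg (ΣSeq w)) (powℚ-nonNeg (suc T) (÷ℕ-nonNeg (suc T) 0≤B)))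
... | yes supp = cp-bound-step w (≢-sym (<⇒≢ (sum-pos 0≤w supp))) C≤B λ a →
  cp-bound T (fiber w a) (λ y → 0≤w (consSeq a y)) (p≤q⇒0≤q-p C≤B) (fiber-condCpSum-≤ w bound a)
  where
  C≤B = marginalCp-≤ w bound supp

lemma2p2 : (T : ℕ) .{{_ : NonZero T}} (n : Fin T → ℕ) (p : Seq T n → ℚ)
    → (∀ x → 0ℚ ≤ p x) → ΣSeq p ≡ 1ℚ
    → (α : ℚ) → 0ℚ < α
    → (∀ x → 0ℚ < p x → (+ 1 / T) * sumℚ (map (λ i → condCp p i x) (allFin T)) ≤ α)
    → cp p ≤ powℚ α T
lemma2p2 (suc m) n p 0≤p Σp≡1 α 0<α mean≤α = begin
  cp p
    ≤⟨ cp-bound (suc m) p 0≤p 0≤Tα sum≤Tα ⟩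
  (ΣSeq p * ΣSeq p) * powℚ ((fromℕ (suc m) * α) ÷ℕ suc m) (suc m)
    ≡⟨ cong₂ (λ s β → (s * s) * powℚ β (suc m)) Σp≡1 (÷ℕ-*-cancel m α) ⟩
  (1ℚ * 1ℚ) * powℚ α (suc m)
    ≡⟨ solve 1 (λ q → (con 1ℚ :* con 1ℚ) :* q := q) refl (powℚ α (suc m)) ⟩
  powℚ α (suc m) ∎
  where
  open ≤-Reasoning
  0≤Tα : 0ℚ ≤ fromℕ (suc m) * α
  0≤Tα = *-nonNeg (fromℕ-nonNeg (suc m)) (<⇒≤ 0<α)
  sum≤Tα : ∀ x → 0ℚ < p x → condCpSum p x ≤ fromℕ (suc m) * α
  sum≤Tα x 0<px = subst (_≤ fromℕ (suc m) * α) (*-÷ℕ-cancel m (condCpSum p x))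
    (*-monoˡ-≤-nonNeg (fromℕ (suc m)) {{nonNegative (fromℕ-nonNeg (suc m))}} (mean≤α x 0<px))
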